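{- Let $p,q,k$ be fixed nonnegative integers. Then $\beta_{p,q}(n,k)>0$ for all sufficiently large $n$ if and only if $p+q<k$. Moreover, if $p+q<k$, then $\beta_{p,q}(n,k)=\Theta(n^{k-1-p-q})$ as $n\to\infty$.
   Context: $[n]=\{1,\dots,n\}$ and $\binom{[n]}{k}$ is the family of all $k$-subsets of $[n]$. A family $\mathcal{F}$ is intersecting if $F\cap F'\neq\emptyset$ for all $F,F'\in\mathcal{F}$. For a family $\mathcal{F}$ and disjoint sets $A,B$, let $\mathcal{F}(A,\overline{B})=\{F\in\mathcal{F}: A\subseteq F,\ B\cap F=\emptyset\}$. For $\mathcal{F}\subseteq 2^{[n]}$, $\beta_{p,q}(\mathcal{F})=\min\{|\mathcal{F}(A,\overline{B})|: |A|=p,\ |B|=q,\ A\cap B=\emptyset,\ A,B\subseteq[n]\}$, and $\beta_{p,q}(n,k)=\max\{\beta_{p,q}(\mathcal{F}): \mathcal{F}\subseteq\binom{[n]}{k},\ \mathcal{F}\text{ intersecting}\}$. -}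

module Defs where

open import Data.Nat using (ℕ; zero; suc; _≟_; _⊓_; _⊔_)
open import Data.List using (List; []; _∷_; map; _++_; filter; length; foldr; concatMap)
open import Data.List.Relation.Unary.All using (All; all?)
open import Data.Vec using ([]; _∷_)
open import Data.Fin.Subset using (Subset; _∩_; _⊆_; ∣_∣; inside; outside; Nonempty; Empty)
open import Data.Fin.Subset.Properties using (nonempty?; _⊆?_)
open import Data.Product using (_×_; _,_)
open import Relation.Nullary using (Dec; ¬?)
open import Relation.Nullary.Decidable using (_×-dec_)

subsets : (n : ℕ) → List (Subset n)
subsets zero = [] ∷ []
subsets (suc n) = map (outside ∷_) (subsets n) ++ map (inside ∷_) (subsets n)

kSubsets : (n k : ℕ) → List (Subset n)
kSubsets n k = filter (λ S → ∣ S ∣ ≟ k) (subsets n)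

-- All sublists of a list: for a duplicate-free list, all its subfamilies.
sublists : ∀ {a} {A : Set a} → List A → List (List A)
sublists [] = [] ∷ []
sublists (x ∷ xs) = sublists xs ++ map (x ∷_) (sublists xs)

Intersecting : ∀ {n} → List (Subset n) → Set
Intersecting 𝓕 = All (λ F → All (λ F' → Nonempty (F ∩ F')) 𝓕) 𝓕

intersecting? : ∀ {n} (𝓕 : List (Subset n)) → Dec (Intersecting 𝓕)
intersecting? 𝓕 = all? (λ F → all? (λ F' → nonempty? (F ∩ F')) 𝓕) 𝓕

restrictCount : ∀ {n} → List (Subset n) → Subset n → Subset n → ℕ
restrictCount 𝓕 A B = length (filter (λ F → (A ⊆? F) ×-dec ¬? (nonempty? (B ∩ F))) 𝓕)

pairs : (n p q : ℕ) → List (Subset n × Subset n)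
pairs n p q =
  filter (λ AB → ¬? (nonempty? (Data.Product.proj₁ AB ∩ Data.Product.proj₂ AB)))
    (concatMap (λ A → map (λ B → A , B) (kSubsets n q)) (kSubsets n p))

-- minimum of a list of naturals (convention: 0 on the empty list)
minL : List ℕ → ℕ
minL [] = 0
minL (x ∷ xs) = foldr _⊓_ x xs

maxL : List ℕ → ℕ
maxL = foldr _⊔_ 0

betaF : (p q : ℕ) → ∀ {n} → List (Subset n) → ℕ
betaF p q {n} 𝓕 = minL (map (λ AB → restrictCount 𝓕 (Data.Product.proj₁ AB) (Data.Product.proj₂ AB)) (pairs n p q))

beta : (p q n k : ℕ) → ℕ
beta p q n k = maxL (map (betaF p q) (filter intersecting? (sublists (kSubsets n k))))

-- For an intersecting family 𝓕 of k-sets, if every member meets Y in at least j points, then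
-- adding to Y, for each subset Z ⊆ Y that is not a transversal of 𝓕, one member of 𝓕 disjoint from Z yields a set
-- Y′ of size at most |Y| + 2^|Y| k that every member meets in at least j + 1 points (a member G with |G ∩ Y| = j
-- meets the member added for Z = G ∩ Y outside Y). After q + 1 rounds either 𝓕 has a transversal of size at most q,
-- which we put inside B so that 𝓕(A, B̄) = ∅, or there is a kernel Y of size O(1) that every member meets in q + 1
-- points; choosing A disjoint from Y, every member of 𝓕(A, B̄) is a k-set containing A and q + 1 points of Y, and
-- there are at most |Y|^(q+1) n^(k-1-p-q) of them, none at all when k ≤ p + q.
--
-- If |T| = 2q + 1, the k-sets containing at least q + 1 points of T form an intersecting family. For
-- any disjoint A, B with |A| = p, |B| = q pick q + 1 points Z ⊆ T ∖ B and pad A ∪ Z to a set W of p + q + 1 points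
-- avoiding B: every k-set containing W and avoiding B lies in 𝓕(A, B̄), and there are
-- binomial(n - p - 2q - 1, k - 1 - p - q) = Θ(n^(k-1-p-q)) of them.

module Submission where

open import Defs
open import Data.Bool.Base using (Bool; true; false)
open import Data.Empty using (⊥-elim)
open import Data.Fin.Base using (zero; suc)
open import Data.Fin.Subset
  using (Subset; ⋃; _∩_; _∪_; _⊆_; _∈_; _∉_; ∁; ⊥; ⊤; ∣_∣; Nonempty; Empty; inside; outside)
open import Data.Fin.Subset.Properties
  using (nonempty?; _⊆?_; ∉⊥; drop-∷-⊆; drop-∷-Empty; out⊆; in⊆in; Empty-unique; p⊆q⇒∣p∣≤∣q∣; p⊂q⇒∣p∣<∣q∣;
         ∣p∣≤n; ∣⊥∣≡0; ∣⊤∣≡n; ∣∁p∣≡n∸∣p∣; p∩q⊆p; p∩q⊆q; p⊆p∪q; q⊆p∪q; x∈p∩q⁺; x∈p∩q⁻; x∈p∪q⁻; x∈∁p⇒x∉p)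
open import Data.List.Base using (List; []; _∷_; map; _++_; filter; length; foldr; concatMap)
open import Data.List.Properties
  using (length-map; length-++; filter-++; filter-≐; filter-none; filter-accept; filter-reject)
open import Data.List.Membership.Propositional using (find; lose) renaming (_∈_ to _∈ₗ_)
open import Data.List.Membership.Propositional.Properties
  using (∈-++⁻; ∈-++⁺ˡ; ∈-++⁺ʳ; ∈-map⁺; ∈-map⁻; ∈-filter⁺; ∈-filter⁻; ∈-concatMap⁺; ∈-concatMap⁻)
open import Data.List.Relation.Unary.All as All using (All; all?)
open import Data.List.Relation.Unary.All.Properties using (¬All⇒Any¬) renaming (map⁺ to All-map⁺)
open import Data.List.Relation.Unary.Any using (here; there; any?)
open import Data.List.Relation.Binary.Sublist.Propositional
  using ([]; _∷_; _∷ʳ_; ⊆-trans; lookup) renaming (_⊆_ to _⊑_)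
open import Data.List.Relation.Binary.Sublist.Propositional.Properties using (filter⁺; filter-⊆; length-mono-≤)
open import Data.Nat.Base
  using (ℕ; zero; suc; _+_; _*_; _∸_; _^_; _!; _⊓_; _≤_; _<_; _≤′_; ≤′-refl; ≤′-step; z≤n; s≤s; s≤s⁻¹)
open import Data.Nat.Properties
open import Data.Nat.Combinatorics using (nCk+nC[k+1]≡[n+1]C[k+1]; nC1≡n) renaming (_C_ to _choose_)
open import Data.Nat.Tactic.RingSolver using (solve-∀)
open import Data.Product using (_×_; _,_; proj₁; proj₂; ∃-syntax; Σ-syntax)
open import Data.Sum using (_⊎_; inj₁; inj₂; [_,_])
open import Data.Vec.Base using ([]; _∷_; here; there)
open import Function using (_∘_; const)
open import Function.Bundles using (_⇔_; mk⇔)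
open import Relation.Binary.PropositionalEquality
  using (_≡_; refl; sym; trans; cong; cong₂; subst; subst₂; module ≡-Reasoning)
open import Relation.Nullary using (¬_; Dec; yes; no; ¬?)
open import Relation.Nullary.Decidable using (_×-dec_)
open import Relation.Unary using (Pred; Decidable)

module _ {a p q} {A : Set a} {P : Pred A p} {Q : Pred A q} (P? : Decidable P) (Q? : Decidable Q) where

  length-filter-≤ : ∀ xs → (∀ {x} → x ∈ₗ xs → P x → Q x) → length (filter P? xs) ≤ length (filter Q? xs)
  length-filter-≤ []       P⇒Q = z≤n
  length-filter-≤ (x ∷ xs) P⇒Q with P? x | Q? x
  ... | yes _  | yes _  = s≤s (length-filter-≤ xs (P⇒Q ∘ there))
  ... | yes px | no ¬qx = ⊥-elim (¬qx (P⇒Q (here refl) px))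
  ... | no _   | yes _  = m≤n⇒m≤1+n (length-filter-≤ xs (P⇒Q ∘ there))
  ... | no _   | no _   = length-filter-≤ xs (P⇒Q ∘ there)

  filter-absorbs : (∀ {x} → P x → Q x) → ∀ xs → filter P? (filter Q? xs) ≡ filter P? xs
  filter-absorbs P⇒Q []       = refl
  filter-absorbs P⇒Q (x ∷ xs) with Q? x
  ... | no ¬qx = trans (filter-absorbs P⇒Q xs) (sym (filter-reject P? (¬qx ∘ P⇒Q)))
  ... | yes _ with P? x
  ...   | yes _ = cong (x ∷_) (filter-absorbs P⇒Q xs)
  ...   | no _  = filter-absorbs P⇒Q xs

module _ {a p q r} {A : Set a} {P : Pred A p} {Q : Pred A q} {R : Pred A r}
         (P? : Decidable P) (Q? : Decidable Q) (R? : Decidable R) where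

  length-filter-≤-filter∘filter : (∀ {x} → P x → Q x) → (∀ {x} → P x → R x) → ∀ xs →
                                  length (filter P? xs) ≤ length (filter R? (filter Q? xs))
  length-filter-≤-filter∘filter P⇒Q P⇒R xs = begin
    length (filter P? xs)                ≡⟨ cong length (filter-absorbs P? Q? P⇒Q xs) ⟨
    length (filter P? (filter Q? xs))    ≤⟨ length-filter-≤ P? R? (filter Q? xs) (λ _ → P⇒R) ⟩
    length (filter R? (filter Q? xs))    ∎
    where open ≤-Reasoning

module _ {a b p} {A : Set a} {B : Set b} {P : Pred B p} (P? : Decidable P) (f : A → B) where

  length-filter-map : ∀ xs → length (filter P? (map f xs)) ≡ length (filter (P? ∘ f) xs)
  length-filter-map []       = refl
  length-filter-map (x ∷ xs) with P? (f x)
  ... | yes _ = cong suc (length-filter-map xs)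
  ... | no _  = length-filter-map xs

module _ {a} {A : Set a} where

  sublists-⊑ : ∀ {ys xs : List A} → ys ∈ₗ sublists xs → ys ⊑ xs
  sublists-⊑ {xs = []}     (here refl) = []
  sublists-⊑ {xs = x ∷ xs} ys∈ with ∈-++⁻ (sublists xs) ys∈
  ... | inj₁ ys∈′ = x ∷ʳ sublists-⊑ ys∈′
  ... | inj₂ ys∈′ with ∈-map⁻ (x ∷_) ys∈′
  ...   | zs , zs∈ , refl = refl ∷ sublists-⊑ zs∈

  filter∈sublists : ∀ {p} {P : Pred A p} (P? : Decidable P) xs → filter P? xs ∈ₗ sublists xs
  filter∈sublists P? []       = here refl
  filter∈sublists P? (x ∷ xs) with P? x
  ... | yes _ = ∈-++⁺ʳ (sublists xs) (∈-map⁺ (x ∷_) (filter∈sublists P? xs))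
  ... | no _  = ∈-++⁺ˡ (filter∈sublists P? xs)

foldr-⊓-≤-seed : ∀ {z} zs → foldr _⊓_ z zs ≤ z
foldr-⊓-≤-seed []       = ≤-refl
foldr-⊓-≤-seed (w ∷ zs) = ≤-trans (m⊓n≤n w _) (foldr-⊓-≤-seed zs)

foldr-⊓-≤ : ∀ {z x zs} → x ∈ₗ zs → foldr _⊓_ z zs ≤ x
foldr-⊓-≤ {zs = w ∷ zs} (here refl) = m⊓n≤m w _
foldr-⊓-≤ {zs = w ∷ zs} (there x∈) = ≤-trans (m⊓n≤n w _) (foldr-⊓-≤ x∈)

foldr-⊓-glb : ∀ {m z zs} → m ≤ z → (∀ {x} → x ∈ₗ zs → m ≤ x) → m ≤ foldr _⊓_ z zs
foldr-⊓-glb {zs = []}     m≤z m≤ = m≤z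
foldr-⊓-glb {zs = w ∷ zs} m≤z m≤ = ⊓-glb (m≤ (here refl)) (foldr-⊓-glb m≤z (m≤ ∘ there))

module _ {a} {A : Set a} (f : A → ℕ) where

  maxL-lub : ∀ {m} xs → (∀ {x} → x ∈ₗ xs → f x ≤ m) → maxL (map f xs) ≤ m
  maxL-lub []       f≤m = z≤n
  maxL-lub (x ∷ xs) f≤m = ⊔-lub (f≤m (here refl)) (maxL-lub xs (f≤m ∘ there))

  ≤-maxL : ∀ {x xs} → x ∈ₗ xs → f x ≤ maxL (map f xs)
  ≤-maxL {xs = y ∷ xs} (here refl) = m≤m⊔n (f y) _
  ≤-maxL {xs = y ∷ xs} (there x∈) = ≤-trans (≤-maxL x∈) (m≤n⊔m (f y) _)

  minL-≤ : ∀ {x xs} → x ∈ₗ xs → minL (map f xs) ≤ f x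
  minL-≤ {xs = y ∷ xs} (here refl) = foldr-⊓-≤-seed (map f xs)
  minL-≤ {xs = y ∷ xs} (there x∈) = foldr-⊓-≤ (∈-map⁺ f x∈)

  -- The member x only witnesses that xs is non-empty: minL [] is 0.
  ≤-minL : ∀ {m x xs} → x ∈ₗ xs → (∀ {y} → y ∈ₗ xs → m ≤ f y) → m ≤ minL (map f xs)
  ≤-minL {xs = y ∷ xs} _ m≤f = foldr-⊓-glb (m≤f (here refl)) λ z∈ →
    let w , w∈ , z≡fw = ∈-map⁻ f z∈ in subst (_ ≤_) (sym z≡fw) (m≤f (there w∈))

-- Binomial coefficients

pascal : ∀ n k → suc n choose suc k ≡ n choose k + n choose suc k
pascal n k = sym (nCk+nC[k+1]≡[n+1]C[k+1] n k)

nCk≤[1+n]Ck : ∀ n k → n choose k ≤ suc n choose k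
nCk≤[1+n]Ck n zero    = ≤-refl
nCk≤[1+n]Ck n (suc k) = ≤-trans (m≤n+m (n choose suc k) (n choose k)) (≤-reflexive (sym (pascal n k)))

choose-monoˡ-≤ : ∀ {m n} k → m ≤ n → m choose k ≤ n choose k
choose-monoˡ-≤ k = go ∘ ≤⇒≤′
  where
  go : ∀ {m n} → m ≤′ n → m choose k ≤ n choose k
  go ≤′-refl       = ≤-refl
  go (≤′-step m≤n) = ≤-trans (go m≤n) (nCk≤[1+n]Ck _ k)

nCk≤n^k : ∀ n k → n choose k ≤ n ^ k
nCk≤n^k n       zero    = ≤-refl
nCk≤n^k zero    (suc k) = z≤n
nCk≤n^k (suc n) (suc k) = begin
  suc n choose suc k             ≡⟨ pascal n k ⟩
  n choose k + n choose suc k    ≤⟨ +-mono-≤ (nCk≤n^k n k) (nCk≤n^k n (suc k)) ⟩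
  n ^ k + n * n ^ k              ≤⟨ +-mono-≤ n^k≤ (*-monoʳ-≤ n n^k≤) ⟩
  suc n ^ k + n * suc n ^ k      ∎
  where
  open ≤-Reasoning
  n^k≤ : n ^ k ≤ suc n ^ k
  n^k≤ = ^-monoˡ-≤ k (n≤1+n n)

absorption : ∀ n k → suc k * (suc n choose suc k) ≡ suc n * (n choose k)
absorption zero    zero    = refl
absorption zero    (suc k) = *-zeroʳ (suc (suc k))
absorption (suc n) zero    = begin
  suc (suc n) choose 1 + 0     ≡⟨ +-identityʳ _ ⟩
  suc (suc n) choose 1         ≡⟨ nC1≡n (suc (suc n)) ⟩
  suc (suc n)                  ≡⟨ *-identityʳ (suc (suc n)) ⟨
  suc (suc n) * 1              ∎
  where open ≡-Reasoning
absorption (suc n) (suc k) = begin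
  (2 + k) * ((2 + n) choose (2 + k))                  ≡⟨ cong ((2 + k) *_) (pascal (suc n) (suc k)) ⟩
  (2 + k) * (b + c)                                   ≡⟨ distribute k b c ⟩
  (1 + k) * b + b + (2 + k) * c                       ≡⟨ cong₂ (λ x y → x + b + y) (absorption n k) (absorption n (suc k)) ⟩
  (1 + n) * (n choose k) + b + (1 + n) * (n choose suc k)
                                                      ≡⟨ collect n (n choose k) b (n choose suc k) ⟩
  (1 + n) * (n choose k + n choose suc k) + b         ≡⟨ cong (λ x → (1 + n) * x + b) (pascal n k) ⟨
  (1 + n) * b + b                                     ≡⟨ +-comm ((1 + n) * b) b ⟩
  (2 + n) * b                                         ∎
  where
  open ≡-Reasoning
  b = suc n choose suc k
  c = suc n choose suc (suc k)
  distribute : ∀ k b c → (2 + k) * (b + c) ≡ (1 + k) * b + b + (2 + k) * c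
  distribute = solve-∀
  collect : ∀ n x b y → (1 + n) * x + b + (1 + n) * y ≡ (1 + n) * (x + y) + b
  collect = solve-∀

[1+n∸d]^d≤d!*nCd : ∀ n d → (suc n ∸ d) ^ d ≤ d ! * (n choose d)
[1+n∸d]^d≤d!*nCd n       zero    = ≤-refl
[1+n∸d]^d≤d!*nCd zero    (suc d) = subst (λ x → x * x ^ d ≤ suc d ! * 0) (sym (0∸n≡0 d)) z≤n
[1+n∸d]^d≤d!*nCd (suc n) (suc d) = begin
  (suc n ∸ d) * (suc n ∸ d) ^ d         ≤⟨ *-mono-≤ (m∸n≤m (suc n) d) ([1+n∸d]^d≤d!*nCd n d) ⟩
  suc n * (d ! * (n choose d))          ≡⟨ x*[y*z]≡y*[x*z] (suc n) (d !) (n choose d) ⟩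
  d ! * (suc n * (n choose d))          ≡⟨ cong (d ! *_) (absorption n d) ⟨
  d ! * (suc d * (suc n choose suc d))  ≡⟨ x*[y*z]≡y*[x*z] (d !) (suc d) _ ⟩
  suc d * (d ! * (suc n choose suc d))  ≡⟨ *-assoc (suc d) (d !) _ ⟨
  suc d * d ! * (suc n choose suc d)    ∎
  where
  open ≤-Reasoning
  x*[y*z]≡y*[x*z] : ∀ x y z → x * (y * z) ≡ y * (x * z)
  x*[y*z]≡y*[x*z] = solve-∀

[m*n]^k≡m^k*n^k : ∀ m n k → (m * n) ^ k ≡ m ^ k * n ^ k
[m*n]^k≡m^k*n^k m n zero    = refl
[m*n]^k≡m^k*n^k m n (suc k) = begin
  m * n * (m * n) ^ k        ≡⟨ cong (m * n *_) ([m*n]^k≡m^k*n^k m n k) ⟩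
  m * n * (m ^ k * n ^ k)    ≡⟨ interchange m n (m ^ k) (n ^ k) ⟩
  m * m ^ k * (n * n ^ k)    ∎
  where
  open ≡-Reasoning
  interchange : ∀ a b x y → a * b * (x * y) ≡ a * x * (b * y)
  interchange = solve-∀

n≤2*[1+n∸c∸d] : ∀ n c d → 2 * (c + d) ≤ n → n ≤ 2 * (suc (n ∸ c) ∸ d)
n≤2*[1+n∸c∸d] n c d 2[c+d]≤n = begin
  n                          ≡⟨ m+[n∸m]≡n c+d≤n ⟨
  (c + d) + r                ≤⟨ +-monoˡ-≤ r c+d≤r ⟩
  r + r                      ≡⟨ cong (r +_) (+-identityʳ r) ⟨
  2 * r                      ≤⟨ *-monoʳ-≤ 2 r≤ ⟩
  2 * (suc (n ∸ c) ∸ d)      ∎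
  where
  open ≤-Reasoning
  r = n ∸ (c + d)
  2[c+d]≤n′ : (c + d) + (c + d) ≤ n
  2[c+d]≤n′ = subst (_≤ n) (cong ((c + d) +_) (+-identityʳ (c + d))) 2[c+d]≤n
  c+d≤n : c + d ≤ n
  c+d≤n = ≤-trans (m≤m+n (c + d) (c + d)) 2[c+d]≤n′
  c+d≤r : c + d ≤ r
  c+d≤r = m+n≤o⇒m≤o∸n (c + d) 2[c+d]≤n′
  r≤ : r ≤ suc (n ∸ c) ∸ d
  r≤ = ≤-trans (≤-reflexive (sym (∸-+-assoc n c d))) (∸-monoˡ-≤ d (n≤1+n (n ∸ c)))

n^d≤[2^d*d!]*[n∸c]Cd : ∀ n c d → 2 * (c + d) ≤ n → n ^ d ≤ (2 ^ d * d !) * ((n ∸ c) choose d)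
n^d≤[2^d*d!]*[n∸c]Cd n c d 2[c+d]≤n = begin
  n ^ d                                ≤⟨ ^-monoˡ-≤ d (n≤2*[1+n∸c∸d] n c d 2[c+d]≤n) ⟩
  (2 * m) ^ d                          ≡⟨ [m*n]^k≡m^k*n^k 2 m d ⟩
  2 ^ d * m ^ d                        ≤⟨ *-monoʳ-≤ (2 ^ d) ([1+n∸d]^d≤d!*nCd (n ∸ c) d) ⟩
  2 ^ d * (d ! * ((n ∸ c) choose d))   ≡⟨ *-assoc (2 ^ d) (d !) _ ⟨
  2 ^ d * d ! * ((n ∸ c) choose d)     ∎
  where
  open ≤-Reasoning
  m = suc (n ∸ c) ∸ d

k≡p+[1+q]+[k∸1∸p∸q] : ∀ p q k → p + q < k → k ≡ p + suc q + (k ∸ 1 ∸ p ∸ q)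
k≡p+[1+q]+[k∸1∸p∸q] p q k p+q<k = begin
  k                                 ≡⟨ m+[n∸m]≡n p+q<k ⟨
  suc (p + q) + (k ∸ suc (p + q))   ≡⟨ cong₂ _+_ (+-suc p q) (∸-+-assoc k 1 (p + q)) ⟨
  p + suc q + (k ∸ 1 ∸ (p + q))     ≡⟨ cong (p + suc q +_) (∸-+-assoc (k ∸ 1) p q) ⟨
  p + suc q + (k ∸ 1 ∸ p ∸ q)       ∎
  where open ≡-Reasoning

-- Counting subsets of [n]

∈-subsets : ∀ {n} (S : Subset n) → S ∈ₗ subsets n
∈-subsets []          = here refl
∈-subsets (false ∷ S) = ∈-++⁺ˡ (∈-map⁺ (outside ∷_) (∈-subsets S))
∈-subsets (true ∷ S)  = ∈-++⁺ʳ (map (outside ∷_) (subsets _)) (∈-map⁺ (inside ∷_) (∈-subsets S))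

-- Opaque so that unification can recover P? from count P?; the lemmas below are its whole interface.
opaque
  count : ∀ {n p} {P : Pred (Subset n) p} → Decidable P → ℕ
  count {n} P? = length (filter P? (subsets n))

opaque
  unfolding count

  count-none : ∀ {n p} {P : Pred (Subset n) p} (P? : Decidable P) → (∀ {S} → ¬ P S) → count P? ≡ 0
  count-none {n} P? ¬P = cong length (filter-none P? (All.universal (λ _ → ¬P) (subsets n)))

  count-mono : ∀ {n p q} {P : Pred (Subset n) p} {Q : Pred (Subset n) q} (P? : Decidable P) (Q? : Decidable Q) →
               (∀ {S} → P S → Q S) → count P? ≤ count Q?
  count-mono {n} P? Q? P⇒Q = length-filter-≤ P? Q? (subsets n) (λ _ → P⇒Q)

  count-≐ : ∀ {n p q} {P : Pred (Subset n) p} {Q : Pred (Subset n) q} (P? : Decidable P) (Q? : Decidable Q) →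
            (∀ {S} → P S → Q S) → (∀ {S} → Q S → P S) → count P? ≡ count Q?
  count-≐ {n} P? Q? P⇒Q Q⇒P = cong length (filter-≐ P? Q? (P⇒Q , Q⇒P) (subsets n))

  count≡length-filter : ∀ {n p} {P : Pred (Subset n) p} (P? : Decidable P) →
                        count P? ≡ length (filter P? (subsets n))
  count≡length-filter P? = refl

  count-[] : ∀ {p} {P : Pred (Subset 0) p} (P? : Decidable P) → P [] → count P? ≡ 1
  count-[] P? P[] = cong length (filter-accept P? P[])

  count-suc : ∀ {n p} {P : Pred (Subset (suc n)) p} (P? : Decidable P) →
              count P? ≡ count (P? ∘ (outside ∷_)) + count (P? ∘ (inside ∷_))
  count-suc {n} P? = begin
    length (filter P? (outs ++ ins))                        ≡⟨ cong length (filter-++ P? outs ins) ⟩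
    length (filter P? outs ++ filter P? ins)                ≡⟨ length-++ (filter P? outs) ⟩
    length (filter P? outs) + length (filter P? ins)        ≡⟨ cong₂ _+_ (length-filter-map P? (outside ∷_) (subsets n))
                                                                         (length-filter-map P? (inside ∷_) (subsets n)) ⟩
    count (P? ∘ (outside ∷_)) + count (P? ∘ (inside ∷_))    ∎
    where
    open ≡-Reasoning
    outs ins : List (Subset (suc n))
    outs = map (outside ∷_) (subsets n)
    ins  = map (inside ∷_) (subsets n)

∣p∪q∣+∣p∩q∣≡∣p∣+∣q∣ : ∀ {n} (p q : Subset n) → ∣ p ∪ q ∣ + ∣ p ∩ q ∣ ≡ ∣ p ∣ + ∣ q ∣
∣p∪q∣+∣p∩q∣≡∣p∣+∣q∣ []          []          = refl
∣p∪q∣+∣p∩q∣≡∣p∣+∣q∣ (false ∷ p) (false ∷ q) = ∣p∪q∣+∣p∩q∣≡∣p∣+∣q∣ p q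
∣p∪q∣+∣p∩q∣≡∣p∣+∣q∣ (false ∷ p) (true ∷ q)  =
  trans (cong suc (∣p∪q∣+∣p∩q∣≡∣p∣+∣q∣ p q)) (sym (+-suc ∣ p ∣ ∣ q ∣))
∣p∪q∣+∣p∩q∣≡∣p∣+∣q∣ (true ∷ p)  (false ∷ q) = cong suc (∣p∪q∣+∣p∩q∣≡∣p∣+∣q∣ p q)
∣p∪q∣+∣p∩q∣≡∣p∣+∣q∣ (true ∷ p)  (true ∷ q)  =
  trans (+-suc (suc ∣ p ∪ q ∣) ∣ p ∩ q ∣)
        (trans (cong (2 +_) (∣p∪q∣+∣p∩q∣≡∣p∣+∣q∣ p q)) (cong suc (sym (+-suc ∣ p ∣ ∣ q ∣))))

∣p∪q∣≤∣p∣+∣q∣ : ∀ {n} (p q : Subset n) → ∣ p ∪ q ∣ ≤ ∣ p ∣ + ∣ q ∣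
∣p∪q∣≤∣p∣+∣q∣ p q = ≤-trans (m≤m+n ∣ p ∪ q ∣ ∣ p ∩ q ∣) (≤-reflexive (∣p∪q∣+∣p∩q∣≡∣p∣+∣q∣ p q))

Empty⇒∣p∣≡0 : ∀ {n} {p : Subset n} → Empty p → ∣ p ∣ ≡ 0
Empty⇒∣p∣≡0 {n} p-empty = trans (cong ∣_∣ (Empty-unique p-empty)) (∣⊥∣≡0 n)

Empty⇒∣p∪q∣≡∣p∣+∣q∣ : ∀ {n} {p q : Subset n} → Empty (p ∩ q) → ∣ p ∪ q ∣ ≡ ∣ p ∣ + ∣ q ∣
Empty⇒∣p∪q∣≡∣p∣+∣q∣ {p = p} {q} p∩q-empty = begin
  ∣ p ∪ q ∣                  ≡⟨ +-identityʳ ∣ p ∪ q ∣ ⟨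
  ∣ p ∪ q ∣ + 0              ≡⟨ cong (∣ p ∪ q ∣ +_) (Empty⇒∣p∣≡0 p∩q-empty) ⟨
  ∣ p ∪ q ∣ + ∣ p ∩ q ∣      ≡⟨ ∣p∪q∣+∣p∩q∣≡∣p∣+∣q∣ p q ⟩
  ∣ p ∣ + ∣ q ∣              ∎
  where open ≡-Reasoning

∣p∣+∣q∣≤∣r∣+∣p∩q∣ : ∀ {n} {p q r : Subset n} → p ⊆ r → q ⊆ r → ∣ p ∣ + ∣ q ∣ ≤ ∣ r ∣ + ∣ p ∩ q ∣
∣p∣+∣q∣≤∣r∣+∣p∩q∣ {p = p} {q} {r} p⊆r q⊆r = begin
  ∣ p ∣ + ∣ q ∣              ≡⟨ ∣p∪q∣+∣p∩q∣≡∣p∣+∣q∣ p q ⟨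
  ∣ p ∪ q ∣ + ∣ p ∩ q ∣      ≤⟨ +-monoˡ-≤ ∣ p ∩ q ∣ (p⊆q⇒∣p∣≤∣q∣ p∪q⊆r) ⟩
  ∣ r ∣ + ∣ p ∩ q ∣          ∎
  where
  open ≤-Reasoning
  p∪q⊆r : p ∪ q ⊆ r
  p∪q⊆r x∈ = [ p⊆r , q⊆r ] (x∈p∪q⁻ p q x∈)

∣p∣>0⇒Nonempty : ∀ {n} (p : Subset n) → 0 < ∣ p ∣ → Nonempty p
∣p∣>0⇒Nonempty p 0<∣p∣ with nonempty? p
... | yes p-nonempty = p-nonempty
... | no  p-empty    = ⊥-elim (<⇒≢ 0<∣p∣ (sym (Empty⇒∣p∣≡0 p-empty)))

Empty-∩⁺ : ∀ {n} {p q : Subset n} → (∀ {x} → x ∈ p → x ∉ q) → Empty (p ∩ q)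
Empty-∩⁺ {p = p} {q} disjoint (x , x∈p∩q) = let x∈p , x∈q = x∈p∩q⁻ p q x∈p∩q in disjoint x∈p x∈q

Empty-∩⁻ : ∀ {n} {p q : Subset n} {x} → Empty (p ∩ q) → x ∈ p → x ∉ q
Empty-∩⁻ p∩q-empty x∈p x∈q = p∩q-empty (_ , x∈p∩q⁺ (x∈p , x∈q))

Empty-∩-swap : ∀ {n} {p q : Subset n} → Empty (p ∩ q) → Empty (q ∩ p)
Empty-∩-swap p∩q-empty = Empty-∩⁺ λ x∈q x∈p → Empty-∩⁻ p∩q-empty x∈p x∈q

∣p∣≤∣p∩∁q∣+∣q∣ : ∀ {n} (p q : Subset n) → ∣ p ∣ ≤ ∣ p ∩ ∁ q ∣ + ∣ q ∣
∣p∣≤∣p∩∁q∣+∣q∣ []          []          = z≤n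
∣p∣≤∣p∩∁q∣+∣q∣ (true ∷ p)  (false ∷ q) = s≤s (∣p∣≤∣p∩∁q∣+∣q∣ p q)
∣p∣≤∣p∩∁q∣+∣q∣ (true ∷ p)  (true ∷ q)  =
  ≤-trans (s≤s (∣p∣≤∣p∩∁q∣+∣q∣ p q)) (≤-reflexive (sym (+-suc _ ∣ q ∣)))
∣p∣≤∣p∩∁q∣+∣q∣ (false ∷ p) (false ∷ q) = ∣p∣≤∣p∩∁q∣+∣q∣ p q
∣p∣≤∣p∩∁q∣+∣q∣ (false ∷ p) (true ∷ q)  =
  ≤-trans (m≤n⇒m≤1+n (∣p∣≤∣p∩∁q∣+∣q∣ p q)) (≤-reflexive (sym (+-suc _ ∣ q ∣)))

∷⊆inside∷ : ∀ {n a} {A S : Subset n} → A ⊆ S → a ∷ A ⊆ inside ∷ S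
∷⊆inside∷ {a = false} = out⊆
∷⊆inside∷ {a = true}  = in⊆in

inside∷⊈outside∷ : ∀ {n} {A S : Subset n} → ¬ (inside ∷ A ⊆ outside ∷ S)
inside∷⊈outside∷ A⊆S with A⊆S here
... | ()

Empty-outside∷ : ∀ {n} {p : Subset n} → Empty p → Empty (outside ∷ p)
Empty-outside∷ p-empty (suc x , there x∈p) = p-empty (x , x∈p)

¬Empty-inside∷ : ∀ {n} {p : Subset n} → ¬ Empty (inside ∷ p)
¬Empty-inside∷ p-empty = p-empty (zero , here)

subset-of-size : ∀ {n m} (R : Subset n) → m ≤ ∣ R ∣ → ∃[ E ] (E ⊆ R × ∣ E ∣ ≡ m)
subset-of-size {m = zero}  []          _           = [] , (λ ()) , refl
subset-of-size             (false ∷ R) m≤∣R∣       =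
  let E , E⊆R , ∣E∣≡m = subset-of-size R m≤∣R∣ in outside ∷ E , out⊆ E⊆R , ∣E∣≡m
subset-of-size {m = zero}  (true ∷ R)  _           =
  let E , E⊆R , ∣E∣≡0 = subset-of-size R z≤n in outside ∷ E , out⊆ E⊆R , ∣E∣≡0
subset-of-size {m = suc m} (true ∷ R)  (s≤s m≤∣R∣) =
  let E , E⊆R , ∣E∣≡m = subset-of-size R m≤∣R∣ in inside ∷ E , in⊆in E⊆R , cong suc ∣E∣≡m

disjoint-subset-of-size : ∀ {n} m (R : Subset n) → m + ∣ R ∣ ≤ n → ∃[ E ] (Empty (E ∩ R) × ∣ E ∣ ≡ m)
disjoint-subset-of-size m R m+∣R∣≤n =
  let m≤∣∁R∣ = subst (m ≤_) (sym (∣∁p∣≡n∸∣p∣ R)) (m+n≤o⇒m≤o∸n m m+∣R∣≤n)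
      E , E⊆∁R , ∣E∣≡m = subset-of-size (∁ R) m≤∣∁R∣
  in E , Empty-∩⁺ (x∈∁p⇒x∉p ∘ E⊆∁R) , ∣E∣≡m

superset-of-size : ∀ {n} m (W₀ R : Subset n) → ∣ W₀ ∣ ≤ m → m + ∣ R ∣ ≤ n → Empty (W₀ ∩ R) →
                   ∃[ W ] (W₀ ⊆ W × ∣ W ∣ ≡ m × Empty (W ∩ R))
superset-of-size {n} m W₀ R ∣W₀∣≤m m+∣R∣≤n W₀∩R-empty
  with disjoint-subset-of-size (m ∸ ∣ W₀ ∣) (W₀ ∪ R) fits
  where
  fits : (m ∸ ∣ W₀ ∣) + ∣ W₀ ∪ R ∣ ≤ n
  fits = begin
    (m ∸ ∣ W₀ ∣) + ∣ W₀ ∪ R ∣          ≡⟨ cong ((m ∸ ∣ W₀ ∣) +_) (Empty⇒∣p∪q∣≡∣p∣+∣q∣ W₀∩R-empty) ⟩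
    (m ∸ ∣ W₀ ∣) + (∣ W₀ ∣ + ∣ R ∣)    ≡⟨ +-assoc (m ∸ ∣ W₀ ∣) ∣ W₀ ∣ ∣ R ∣ ⟨
    (m ∸ ∣ W₀ ∣) + ∣ W₀ ∣ + ∣ R ∣      ≡⟨ cong (_+ ∣ R ∣) (m∸n+n≡m ∣W₀∣≤m) ⟩
    m + ∣ R ∣                          ≤⟨ m+∣R∣≤n ⟩
    n                                  ∎
    where open ≤-Reasoning
... | E , E∩[W₀∪R]-empty , ∣E∣≡m∸∣W₀∣ = W₀ ∪ E , p⊆p∪q E , ∣W₀∪E∣≡m , Empty-∩⁺ W₀∪E-avoids-R
  where
  ∣W₀∪E∣≡m : ∣ W₀ ∪ E ∣ ≡ m
  ∣W₀∪E∣≡m = trans (Empty⇒∣p∪q∣≡∣p∣+∣q∣ (Empty-∩⁺ λ x∈W₀ x∈E → Empty-∩⁻ E∩[W₀∪R]-empty x∈E (p⊆p∪q R x∈W₀)))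
                   (trans (cong (∣ W₀ ∣ +_) ∣E∣≡m∸∣W₀∣) (m+[n∸m]≡n ∣W₀∣≤m))
  W₀∪E-avoids-R : ∀ {x} → x ∈ W₀ ∪ E → x ∉ R
  W₀∪E-avoids-R x∈W₀∪E x∈R with x∈p∪q⁻ W₀ E x∈W₀∪E
  ... | inj₁ x∈W₀ = Empty-∩⁻ W₀∩R-empty x∈W₀ x∈R
  ... | inj₂ x∈E  = Empty-∩⁻ E∩[W₀∪R]-empty x∈E (q⊆p∪q W₀ R x∈R)

count-⊆ : ∀ {n} (Y : Subset n) → count (_⊆? Y) ≡ 2 ^ ∣ Y ∣
count-⊆ []          = count-[] (_⊆? []) (λ ())
count-⊆ (false ∷ Y) = begin
  count (_⊆? (outside ∷ Y))                                            ≡⟨ count-suc (_⊆? (outside ∷ Y)) ⟩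
  count ((_⊆? (outside ∷ Y)) ∘ (outside ∷_)) + count ((_⊆? (outside ∷ Y)) ∘ (inside ∷_))
    ≡⟨ cong₂ _+_ (trans (count-≐ _ (_⊆? Y) drop-∷-⊆ out⊆) (count-⊆ Y)) (count-none _ inside∷⊈outside∷) ⟩
  2 ^ ∣ Y ∣ + 0                                                        ≡⟨ +-identityʳ _ ⟩
  2 ^ ∣ Y ∣                                                            ∎
  where open ≡-Reasoning
count-⊆ (true ∷ Y) = begin
  count (_⊆? (inside ∷ Y))                                             ≡⟨ count-suc (_⊆? (inside ∷ Y)) ⟩
  count ((_⊆? (inside ∷ Y)) ∘ (outside ∷_)) + count ((_⊆? (inside ∷ Y)) ∘ (inside ∷_))
    ≡⟨ cong₂ _+_ (trans (count-≐ _ (_⊆? Y) drop-∷-⊆ out⊆) (count-⊆ Y))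
                 (trans (count-≐ _ (_⊆? Y) drop-∷-⊆ in⊆in) (count-⊆ Y)) ⟩
  2 ^ ∣ Y ∣ + 2 ^ ∣ Y ∣                                                ≡⟨ cong (2 ^ ∣ Y ∣ +_) (+-identityʳ _) ⟨
  2 ^ suc ∣ Y ∣                                                        ∎
  where open ≡-Reasoning

-- S ∩ B rather than B ∩ S, so that the head of S alone decides the head of the intersection.
Sandwiched : ∀ {n} → ℕ → Subset n → Subset n → Subset n → Set
Sandwiched k A B S = ∣ S ∣ ≡ k × A ⊆ S × Empty (S ∩ B)

sandwiched? : ∀ {n} k (A B : Subset n) → Decidable (Sandwiched k A B)
sandwiched? k A B S = (∣ S ∣ ≟ k) ×-dec (A ⊆? S) ×-dec ¬? (nonempty? (S ∩ B))

sandwichCount : ∀ {n} → ℕ → Subset n → Subset n → ℕ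
sandwichCount k A B = count (sandwiched? k A B)

module SandwichSlices {n} (A B : Subset n) where

  outside∷-outside : ∀ k b → count (sandwiched? k (outside ∷ A) (b ∷ B) ∘ (outside ∷_)) ≡ sandwichCount k A B
  outside∷-outside k b = count-≐ _ _
    (λ (∣S∣≡k , A⊆S , S∩B-empty) → ∣S∣≡k , drop-∷-⊆ A⊆S , drop-∷-Empty S∩B-empty)
    (λ (∣S∣≡k , A⊆S , S∩B-empty) → ∣S∣≡k , out⊆ A⊆S , Empty-outside∷ S∩B-empty)

  outside∷-inside : ∀ k b → count (sandwiched? k (inside ∷ A) (b ∷ B) ∘ (outside ∷_)) ≡ 0
  outside∷-inside k b = count-none _ λ (_ , A⊆S , _) → inside∷⊈outside∷ A⊆S

  inside∷-outside : ∀ a {k k′} → k ≡ suc k′ →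
                    count (sandwiched? k (a ∷ A) (outside ∷ B) ∘ (inside ∷_)) ≡ sandwichCount k′ A B
  inside∷-outside a refl = count-≐ _ _
    (λ (∣S∣≡k , A⊆S , S∩B-empty) → suc-injective ∣S∣≡k , drop-∷-⊆ A⊆S , drop-∷-Empty S∩B-empty)
    (λ (∣S∣≡k , A⊆S , S∩B-empty) → cong suc ∣S∣≡k , ∷⊆inside∷ A⊆S , Empty-outside∷ S∩B-empty)

  inside∷-inside : ∀ k a → count (sandwiched? k (a ∷ A) (inside ∷ B) ∘ (inside ∷_)) ≡ 0
  inside∷-inside k a = count-none _ λ (_ , _ , S∩B-empty) → ¬Empty-inside∷ S∩B-empty

  inside∷-small : ∀ a b {k} → k ≤ ∣ A ∣ → count (sandwiched? k (a ∷ A) (b ∷ B) ∘ (inside ∷_)) ≡ 0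
  inside∷-small a b k≤∣A∣ = count-none _ λ (∣S∣≡k , A⊆S , _) →
    <⇒≱ (≤-trans (s≤s (p⊆q⇒∣p∣≤∣q∣ (drop-∷-⊆ A⊆S))) (≤-reflexive ∣S∣≡k)) k≤∣A∣

sandwichCount-≡ : ∀ {n} j (A B : Subset n) → Empty (A ∩ B) →
                  sandwichCount (∣ A ∣ + j) A B ≡ ∣ ∁ (A ∪ B) ∣ choose j
sandwichCount-≡ zero    [] [] _ = count-[] (sandwiched? 0 [] []) (refl , (λ ()) , λ ())
sandwichCount-≡ (suc j) [] [] _ = count-none (sandwiched? (suc j) [] []) λ { {[]} (() , _) }
sandwichCount-≡ j (a ∷ A) (b ∷ B) A∩B-empty =
  trans (count-suc (sandwiched? (∣ a ∷ A ∣ + j) (a ∷ A) (b ∷ B))) (slices a b j A∩B-empty)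
  where
  open SandwichSlices A B
  open ≡-Reasoning
  IH : ∀ j → sandwichCount (∣ A ∣ + j) A B ≡ ∣ ∁ (A ∪ B) ∣ choose j
  IH j = sandwichCount-≡ j A B (drop-∷-Empty A∩B-empty)
  m = ∣ ∁ (A ∪ B) ∣
  outs ins : Bool → Bool → ℕ → ℕ
  outs a b k = count (sandwiched? k (a ∷ A) (b ∷ B) ∘ (outside ∷_))
  ins  a b k = count (sandwiched? k (a ∷ A) (b ∷ B) ∘ (inside ∷_))
  slices : ∀ a b j → Empty ((a ∷ A) ∩ (b ∷ B)) →
           outs a b (∣ a ∷ A ∣ + j) + ins a b (∣ a ∷ A ∣ + j) ≡ ∣ ∁ ((a ∷ A) ∪ (b ∷ B)) ∣ choose j
  slices true  true  j A∩B-empty = ⊥-elim (¬Empty-inside∷ A∩B-empty)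
  slices true  false j _ = cong₂ _+_ (outside∷-inside _ false) (trans (inside∷-outside true refl) (IH j))
  slices false true  j _ = begin
    outs false true _ + ins false true _     ≡⟨ cong₂ _+_ (trans (outside∷-outside _ true) (IH j)) (inside∷-inside _ false) ⟩
    m choose j + 0                           ≡⟨ +-identityʳ (m choose j) ⟩
    m choose j                               ∎
  slices false false zero _ =
    cong₂ _+_ (trans (outside∷-outside _ false) (IH 0)) (inside∷-small false false (≤-reflexive (+-identityʳ ∣ A ∣)))
  slices false false (suc j) _ = begin
    outs false false _ + ins false false _   ≡⟨ cong₂ _+_ (trans (outside∷-outside _ false) (IH (suc j)))
                                                          (trans (inside∷-outside false (+-suc ∣ A ∣ j)) (IH j)) ⟩
    m choose suc j + m choose j              ≡⟨ +-comm (m choose suc j) (m choose j) ⟩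
    m choose j + m choose suc j              ≡⟨ pascal m j ⟨
    suc m choose suc j                       ∎

Heavy : ∀ {n} → ℕ → Subset n → Subset n → ℕ → Subset n → Set
Heavy k A Y r S = ∣ S ∣ ≡ k × A ⊆ S × r ≤ ∣ S ∩ Y ∣

heavy? : ∀ {n} k (A Y : Subset n) r → Decidable (Heavy k A Y r)
heavy? k A Y r S = (∣ S ∣ ≟ k) ×-dec (A ⊆? S) ×-dec (r ≤? ∣ S ∩ Y ∣)

heavyCount : ∀ {n} → ℕ → Subset n → Subset n → ℕ → ℕ
heavyCount k A Y r = count (heavy? k A Y r)

∣A∣+∣S∩Y∣≤∣S∣ : ∀ {n} {A S : Subset n} (Y : Subset n) → A ⊆ S → Empty (A ∩ Y) → ∣ A ∣ + ∣ S ∩ Y ∣ ≤ ∣ S ∣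
∣A∣+∣S∩Y∣≤∣S∣ {A = A} {S} Y A⊆S A∩Y-empty = begin
  ∣ A ∣ + ∣ S ∩ Y ∣       ≡⟨ Empty⇒∣p∪q∣≡∣p∣+∣q∣ (Empty-∩⁺ λ x∈A x∈S∩Y → Empty-∩⁻ A∩Y-empty x∈A (p∩q⊆q S Y x∈S∩Y)) ⟨
  ∣ A ∪ (S ∩ Y) ∣         ≤⟨ p⊆q⇒∣p∣≤∣q∣ (λ x∈ → [ A⊆S , p∩q⊆p S Y ] (x∈p∪q⁻ A (S ∩ Y) x∈)) ⟩
  ∣ S ∣                   ∎
  where open ≤-Reasoning

heavyCount-< : ∀ {n k r} (A Y : Subset n) → Empty (A ∩ Y) → k < ∣ A ∣ + r → heavyCount k A Y r ≡ 0
heavyCount-< A Y A∩Y-empty k<∣A∣+r = count-none (heavy? _ A Y _) λ (∣S∣≡k , A⊆S , r≤∣S∩Y∣) →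
  <⇒≱ k<∣A∣+r (≤-trans (+-monoʳ-≤ ∣ A ∣ r≤∣S∩Y∣) (≤-trans (∣A∣+∣S∩Y∣≤∣S∣ Y A⊆S A∩Y-empty) (≤-reflexive ∣S∣≡k)))

module HeavySlices {n} (A Y : Subset n) where

  outside∷-outside : ∀ k r y → count (heavy? k (outside ∷ A) (y ∷ Y) r ∘ (outside ∷_)) ≡ heavyCount k A Y r
  outside∷-outside k r y = count-≐ _ (heavy? k A Y r)
    (λ (∣S∣≡k , A⊆S , r≤) → ∣S∣≡k , drop-∷-⊆ A⊆S , r≤)
    (λ (∣S∣≡k , A⊆S , r≤) → ∣S∣≡k , out⊆ A⊆S , r≤)

  outside∷-inside : ∀ k r y → count (heavy? k (inside ∷ A) (y ∷ Y) r ∘ (outside ∷_)) ≡ 0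
  outside∷-inside k r y = count-none _ λ (_ , A⊆S , _) → inside∷⊈outside∷ A⊆S

  inside∷-outside : ∀ a r {k k′} → k ≡ suc k′ →
                    count (heavy? k (a ∷ A) (outside ∷ Y) r ∘ (inside ∷_)) ≡ heavyCount k′ A Y r
  inside∷-outside a r refl = count-≐ _ (heavy? _ A Y r)
    (λ (∣S∣≡k , A⊆S , r≤) → suc-injective ∣S∣≡k , drop-∷-⊆ A⊆S , r≤)
    (λ (∣S∣≡k , A⊆S , r≤) → cong suc ∣S∣≡k , ∷⊆inside∷ A⊆S , r≤)

  inside∷-inside : ∀ a r {k k′} → k ≡ suc k′ →
                   count (heavy? k (a ∷ A) (inside ∷ Y) (suc r) ∘ (inside ∷_)) ≡ heavyCount k′ A Y r
  inside∷-inside a r refl = count-≐ _ (heavy? _ A Y r)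
    (λ (∣S∣≡k , A⊆S , r≤) → suc-injective ∣S∣≡k , drop-∷-⊆ A⊆S , s≤s⁻¹ r≤)
    (λ (∣S∣≡k , A⊆S , r≤) → cong suc ∣S∣≡k , ∷⊆inside∷ A⊆S , s≤s r≤)

heavyCount-≤ : ∀ {n} r e {k} (A Y : Subset n) → Empty (A ∩ Y) → k ≡ ∣ A ∣ + r + e →
               heavyCount k A Y r ≤ (∣ Y ∣ choose r) * (n choose e)
heavyCount-≤ {n} zero e A Y _ refl = begin
  heavyCount (∣ A ∣ + 0 + e) A Y 0     ≤⟨ count-mono (heavy? _ A Y 0) (sandwiched? _ A ⊥)
                                            (λ (∣S∣≡k , A⊆S , _) → ∣S∣≡k , A⊆S , Empty-∩⁺ λ _ → ∉⊥) ⟩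
  sandwichCount (∣ A ∣ + 0 + e) A ⊥    ≡⟨ cong (λ k → sandwichCount (k + e) A ⊥) (+-identityʳ ∣ A ∣) ⟩
  sandwichCount (∣ A ∣ + e) A ⊥        ≡⟨ sandwichCount-≡ e A ⊥ (Empty-∩⁺ λ _ → ∉⊥) ⟩
  ∣ ∁ (A ∪ ⊥) ∣ choose e               ≤⟨ choose-monoˡ-≤ e (∣p∣≤n (∁ (A ∪ ⊥))) ⟩
  n choose e                           ≡⟨ *-identityˡ (n choose e) ⟨
  (∣ Y ∣ choose 0) * (n choose e)      ∎
  where open ≤-Reasoning
heavyCount-≤ {zero}  (suc r) e [] [] _ _ =
  ≤-trans (≤-reflexive (count-none (heavy? _ [] [] (suc r)) λ { {[]} (_ , _ , ()) })) z≤n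
heavyCount-≤ {suc n} (suc r) e (a ∷ A) (y ∷ Y) A∩Y-empty k≡ =
  ≤-trans (≤-reflexive (count-suc (heavy? _ (a ∷ A) (y ∷ Y) (suc r)))) (slices a y e A∩Y-empty k≡)
  where
  open HeavySlices A Y
  open ≤-Reasoning
  IH : ∀ r e {k} → k ≡ ∣ A ∣ + r + e → heavyCount k A Y r ≤ (∣ Y ∣ choose r) * (n choose e)
  IH r e = heavyCount-≤ r e A Y (drop-∷-Empty A∩Y-empty)
  m = ∣ Y ∣
  outs ins : Bool → Bool → ℕ → ℕ
  outs a y k = count (heavy? k (a ∷ A) (y ∷ Y) (suc r) ∘ (outside ∷_))
  ins  a y k = count (heavy? k (a ∷ A) (y ∷ Y) (suc r) ∘ (inside ∷_))
  slices : ∀ a y e {k} → Empty ((a ∷ A) ∩ (y ∷ Y)) → k ≡ ∣ a ∷ A ∣ + suc r + e →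
           outs a y k + ins a y k ≤ (∣ y ∷ Y ∣ choose suc r) * (suc n choose e)
  slices true true e A∩Y-empty _ = ⊥-elim (¬Empty-inside∷ A∩Y-empty)
  slices true false e _ refl = begin
    outs true false _ + ins true false _             ≡⟨ cong₂ _+_ (outside∷-inside _ (suc r) false)
                                                                  (inside∷-outside true (suc r) refl) ⟩
    heavyCount (∣ A ∣ + suc r + e) A Y (suc r)       ≤⟨ IH (suc r) e refl ⟩
    (m choose suc r) * (n choose e)                  ≤⟨ *-monoʳ-≤ (m choose suc r) (nCk≤[1+n]Ck n e) ⟩
    (m choose suc r) * (suc n choose e)              ∎
  slices false false zero _ k≡ = begin
    outs false false _ + ins false false _           ≡⟨ cong₂ _+_ (outside∷-outside _ (suc r) false)
                                                                  (inside∷-outside false (suc r) k≡1+∣A∣+r) ⟩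
    heavyCount _ A Y (suc r) + heavyCount (∣ A ∣ + r) A Y (suc r)
                                                     ≡⟨ cong (heavyCount _ A Y (suc r) +_) nothing-left ⟩
    heavyCount _ A Y (suc r) + 0                     ≡⟨ +-identityʳ _ ⟩
    heavyCount _ A Y (suc r)                         ≤⟨ IH (suc r) zero k≡ ⟩
    (m choose suc r) * 1                             ∎
    where
    k≡1+∣A∣+r = trans k≡ (trans (+-identityʳ (∣ A ∣ + suc r)) (+-suc ∣ A ∣ r))
    nothing-left = heavyCount-< A Y (drop-∷-Empty A∩Y-empty) (≤-reflexive (sym (+-suc ∣ A ∣ r)))
  slices false false (suc e) _ k≡ = begin
    outs false false _ + ins false false _           ≡⟨ cong₂ _+_ (outside∷-outside _ (suc r) false)
                                                                  (inside∷-outside false (suc r) (trans k≡ (+-suc _ e))) ⟩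
    heavyCount _ A Y (suc r) + heavyCount (∣ A ∣ + suc r + e) A Y (suc r)
                                                     ≤⟨ +-mono-≤ (IH (suc r) (suc e) k≡) (IH (suc r) e refl) ⟩
    (m choose suc r) * (n choose suc e) + (m choose suc r) * (n choose e)
                                                     ≡⟨ *-distribˡ-+ (m choose suc r) (n choose suc e) (n choose e) ⟨
    (m choose suc r) * (n choose suc e + n choose e) ≡⟨ cong ((m choose suc r) *_) (+-comm (n choose suc e) (n choose e)) ⟩
    (m choose suc r) * (n choose e + n choose suc e) ≡⟨ cong ((m choose suc r) *_) (pascal n e) ⟨
    (m choose suc r) * (suc n choose suc e)          ∎
  slices false true e _ k≡ = begin
    outs false true _ + ins false true _             ≡⟨ cong₂ _+_ (outside∷-outside _ (suc r) true)
                                                                  (inside∷-inside false r (trans k≡ (cong (_+ e) (+-suc ∣ A ∣ r)))) ⟩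
    heavyCount _ A Y (suc r) + heavyCount (∣ A ∣ + r + e) A Y r
                                                     ≤⟨ +-mono-≤ (IH (suc r) e k≡) (IH r e refl) ⟩
    (m choose suc r) * (n choose e) + (m choose r) * (n choose e)
                                                     ≡⟨ *-distribʳ-+ (n choose e) (m choose suc r) (m choose r) ⟨
    (m choose suc r + m choose r) * (n choose e)     ≡⟨ cong (_* (n choose e)) (+-comm (m choose suc r) (m choose r)) ⟩
    (m choose r + m choose suc r) * (n choose e)     ≡⟨ cong (_* (n choose e)) (pascal m r) ⟨
    (suc m choose suc r) * (n choose e)              ≤⟨ *-monoʳ-≤ (suc m choose suc r) (nCk≤[1+n]Ck n e) ⟩
    (suc m choose suc r) * (suc n choose e)          ∎

-- Upper bound: transversals and kernels

⊆⋃ : ∀ {n} {p : Subset n} {ps} → p ∈ₗ ps → p ⊆ ⋃ ps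
⊆⋃ {ps = p ∷ ps} (here refl) = p⊆p∪q (⋃ ps)
⊆⋃ {ps = q ∷ ps} (there p∈) = q⊆p∪q q (⋃ ps) ∘ ⊆⋃ p∈

∣⋃∣≤ : ∀ {n k} (ps : List (Subset n)) → All (λ p → ∣ p ∣ ≤ k) ps → ∣ ⋃ ps ∣ ≤ length ps * k
∣⋃∣≤ {n} []       _            = ≤-reflexive (∣⊥∣≡0 n)
∣⋃∣≤     (p ∷ ps) (∣p∣≤k All.∷ ∣ps∣≤k) = ≤-trans (∣p∪q∣≤∣p∣+∣q∣ p (⋃ ps)) (+-mono-≤ ∣p∣≤k (∣⋃∣≤ ps ∣ps∣≤k))

Transversal : ∀ {n} → List (Subset n) → Subset n → Set
Transversal 𝓕 Z = All (λ G → Nonempty (Z ∩ G)) 𝓕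

-- A kernel grows by at most one k-set per subset of it in each of the rounds below.
kernelBound : ℕ → ℕ → ℕ
kernelBound k zero    = 0
kernelBound k (suc j) = kernelBound k j + 2 ^ kernelBound k j * k

module Kernel {n k} (𝓕 : List (Subset n)) (𝓕-intersecting : Intersecting 𝓕)
              (𝓕-uniform : ∀ {G} → G ∈ₗ 𝓕 → ∣ G ∣ ≡ k) where

  transversal? : ∀ Z → Dec (Transversal 𝓕 Z)
  transversal? Z = all? (λ G → nonempty? (Z ∩ G)) 𝓕

  transversal-or-missed : ∀ Z → Transversal 𝓕 Z ⊎ ∃[ G ] (G ∈ₗ 𝓕 × Empty (Z ∩ G))
  transversal-or-missed Z with transversal? Z
  ... | yes Z-transversal = inj₁ Z-transversal
  ... | no ¬Z-transversal = inj₂ (find (¬All⇒Any¬ (λ G → nonempty? (Z ∩ G)) 𝓕 ¬Z-transversal))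

  -- ⊥ is a junk value for transversals Z; there only its size matters.
  missed : Subset n → Subset n
  missed Z = [ const ⊥ , proj₁ ] (transversal-or-missed Z)

  ∣missed∣≤k : ∀ Z → ∣ missed Z ∣ ≤ k
  ∣missed∣≤k Z with transversal-or-missed Z
  ... | inj₁ _             = ≤-trans (≤-reflexive (∣⊥∣≡0 n)) z≤n
  ... | inj₂ (G , G∈𝓕 , _) = ≤-reflexive (𝓕-uniform G∈𝓕)

  missed-avoids : ∀ Z → ¬ Transversal 𝓕 Z → missed Z ∈ₗ 𝓕 × Empty (Z ∩ missed Z)
  missed-avoids Z ¬Z-transversal with transversal-or-missed Z
  ... | inj₁ Z-transversal           = ⊥-elim (¬Z-transversal Z-transversal)
  ... | inj₂ (_ , G∈𝓕 , Z∩G-empty) = G∈𝓕 , Z∩G-empty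

  thicken : Subset n → Subset n
  thicken Y = Y ∪ ⋃ (map missed (filter (_⊆? Y) (subsets n)))

  ∣thicken∣≤ : ∀ Y → ∣ thicken Y ∣ ≤ ∣ Y ∣ + 2 ^ ∣ Y ∣ * k
  ∣thicken∣≤ Y = begin
    ∣ Y ∪ ⋃ (map missed Zs) ∣            ≤⟨ ∣p∪q∣≤∣p∣+∣q∣ Y _ ⟩
    ∣ Y ∣ + ∣ ⋃ (map missed Zs) ∣        ≤⟨ +-monoʳ-≤ ∣ Y ∣ (∣⋃∣≤ (map missed Zs) (All-map⁺ (All.universal ∣missed∣≤k Zs))) ⟩
    ∣ Y ∣ + length (map missed Zs) * k   ≡⟨ cong (λ l → ∣ Y ∣ + l * k) (length-map missed Zs) ⟩
    ∣ Y ∣ + length Zs * k                ≡⟨ cong (λ l → ∣ Y ∣ + l * k) (count≡length-filter (_⊆? Y)) ⟨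
    ∣ Y ∣ + count (_⊆? Y) * k            ≡⟨ cong (λ l → ∣ Y ∣ + l * k) (count-⊆ Y) ⟩
    ∣ Y ∣ + 2 ^ ∣ Y ∣ * k                ∎
    where
    open ≤-Reasoning
    Zs : List (Subset n)
    Zs = filter (_⊆? Y) (subsets n)

  G∩Y⊆G∩thicken : ∀ G Y → G ∩ Y ⊆ G ∩ thicken Y
  G∩Y⊆G∩thicken G Y x∈G∩Y = let x∈G , x∈Y = x∈p∩q⁻ G Y x∈G∩Y in x∈p∩q⁺ (x∈G , p⊆p∪q _ x∈Y)

  -- The member of 𝓕 missing G ∩ Y still meets G (𝓕 is intersecting), at a point outside G ∩ Y that thicken Y contains.
  thicken-grows : ∀ {G} Y → G ∈ₗ 𝓕 → ¬ Transversal 𝓕 (G ∩ Y) → ∣ G ∩ Y ∣ < ∣ G ∩ thicken Y ∣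
  thicken-grows {G} Y G∈𝓕 ¬G∩Y-transversal = p⊂q⇒∣p∣<∣q∣ (G∩Y⊆G∩thicken G Y , w , w∈G∩thicken , w∉G∩Y)
    where
    H∈𝓕,avoids = missed-avoids (G ∩ Y) ¬G∩Y-transversal
    G∩H-nonempty : Nonempty (G ∩ missed (G ∩ Y))
    G∩H-nonempty = All.lookup (All.lookup 𝓕-intersecting G∈𝓕) (proj₁ H∈𝓕,avoids)
    w = proj₁ G∩H-nonempty
    w∈G×w∈H = x∈p∩q⁻ G _ (proj₂ G∩H-nonempty)
    H⊆thicken : missed (G ∩ Y) ⊆ thicken Y
    H⊆thicken = q⊆p∪q Y _ ∘ ⊆⋃ (∈-map⁺ missed (∈-filter⁺ (_⊆? Y) (∈-subsets (G ∩ Y)) (p∩q⊆q G Y)))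
    w∈G∩thicken : w ∈ G ∩ thicken Y
    w∈G∩thicken = x∈p∩q⁺ (proj₁ w∈G×w∈H , H⊆thicken (proj₂ w∈G×w∈H))
    w∉G∩Y : w ∉ G ∩ Y
    w∉G∩Y w∈G∩Y = Empty-∩⁻ (proj₂ H∈𝓕,avoids) w∈G∩Y (proj₂ w∈G×w∈H)

  thicken-or-transversal : ∀ j Y → (∀ {G} → G ∈ₗ 𝓕 → j ≤ ∣ G ∩ Y ∣) →
    (∃[ Z ] (∣ Z ∣ ≡ j × Transversal 𝓕 Z)) ⊎ (∀ {G} → G ∈ₗ 𝓕 → suc j ≤ ∣ G ∩ thicken Y ∣)
  thicken-or-transversal j Y j≤∣G∩Y∣
    with any? (λ Z → (∣ Z ∣ ≟ j) ×-dec transversal? Z) (filter (_⊆? Y) (subsets n))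
  ... | yes found = let Z , _ , ∣Z∣≡j , Z-transversal = find found in inj₁ (Z , ∣Z∣≡j , Z-transversal)
  ... | no  none  = inj₂ grows
    where
    grows : ∀ {G} → G ∈ₗ 𝓕 → suc j ≤ ∣ G ∩ thicken Y ∣
    grows {G} G∈𝓕 with j <? ∣ G ∩ Y ∣ | transversal? (G ∩ Y)
    ... | yes j<∣G∩Y∣ | _ = ≤-trans j<∣G∩Y∣ (p⊆q⇒∣p∣≤∣q∣ (G∩Y⊆G∩thicken G Y))
    ... | no  j≮∣G∩Y∣ | yes G∩Y-transversal =
      ⊥-elim (none (lose (∈-filter⁺ (_⊆? Y) (∈-subsets (G ∩ Y)) (p∩q⊆q G Y)) (∣G∩Y∣≡j , G∩Y-transversal)))
      where ∣G∩Y∣≡j = ≤-antisym (≮⇒≥ j≮∣G∩Y∣) (j≤∣G∩Y∣ G∈𝓕)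
    ... | no  _       | no ¬G∩Y-transversal =
      ≤-trans (s≤s (j≤∣G∩Y∣ G∈𝓕)) (thicken-grows Y G∈𝓕 ¬G∩Y-transversal)

  small-transversal-or-kernel : ∀ j →
    (∃[ Z ] (∣ Z ∣ < j × Transversal 𝓕 Z)) ⊎ (∃[ Y ] (∣ Y ∣ ≤ kernelBound k j × (∀ {G} → G ∈ₗ 𝓕 → j ≤ ∣ G ∩ Y ∣)))
  small-transversal-or-kernel zero = inj₂ (⊥ , ≤-reflexive (∣⊥∣≡0 n) , λ _ → z≤n)
  small-transversal-or-kernel (suc j) with small-transversal-or-kernel j
  ... | inj₁ (Z , ∣Z∣<j , Z-transversal) = inj₁ (Z , m≤n⇒m≤1+n ∣Z∣<j , Z-transversal)
  ... | inj₂ (Y , ∣Y∣≤ , j≤∣G∩Y∣) with thicken-or-transversal j Y j≤∣G∩Y∣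
  ...   | inj₁ (Z , ∣Z∣≡j , Z-transversal) = inj₁ (Z , s≤s (≤-reflexive ∣Z∣≡j) , Z-transversal)
  ...   | inj₂ 1+j≤ = inj₂ (thicken Y , ∣thickenY∣≤ , 1+j≤)
    where
    ∣thickenY∣≤ : ∣ thicken Y ∣ ≤ kernelBound k (suc j)
    ∣thickenY∣≤ = ≤-trans (∣thicken∣≤ Y) (+-mono-≤ ∣Y∣≤ (*-monoˡ-≤ k (^-monoʳ-≤ 2 ∣Y∣≤)))

∈-kSubsets⁻ : ∀ {n k G} → G ∈ₗ kSubsets n k → ∣ G ∣ ≡ k
∈-kSubsets⁻ {n} {k} = proj₂ ∘ ∈-filter⁻ (λ S → ∣ S ∣ ≟ k) {xs = subsets n}

∈-pairs⁺ : ∀ {n p q} {A B : Subset n} → ∣ A ∣ ≡ p → ∣ B ∣ ≡ q → Empty (A ∩ B) → (A , B) ∈ₗ pairs n p q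
∈-pairs⁺ {n} {p} {q} {A} {B} ∣A∣≡p ∣B∣≡q A∩B-empty =
  ∈-filter⁺ _ (∈-concatMap⁺ (λ A → map (A ,_) (kSubsets n q)) (lose A∈ (∈-map⁺ (A ,_) B∈))) A∩B-empty
  where
  A∈ = ∈-filter⁺ (λ S → ∣ S ∣ ≟ p) (∈-subsets A) ∣A∣≡p
  B∈ = ∈-filter⁺ (λ S → ∣ S ∣ ≟ q) (∈-subsets B) ∣B∣≡q

∈-pairs⁻ : ∀ {n p q} {A B : Subset n} → (A , B) ∈ₗ pairs n p q → ∣ A ∣ ≡ p × ∣ B ∣ ≡ q × Empty (A ∩ B)
∈-pairs⁻ {n} {p} {q} AB∈ with ∈-filter⁻ _ {xs = concatMap _ (kSubsets n p)} AB∈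
... | AB∈′ , A∩B-empty with find (∈-concatMap⁻ (λ A → map (A ,_) (kSubsets n q)) {xs = kSubsets n p} AB∈′)
... | A , A∈ , AB∈″ with ∈-map⁻ (A ,_) AB∈″
... | B , B∈ , refl = ∈-kSubsets⁻ A∈ , ∈-kSubsets⁻ B∈ , A∩B-empty

intersectingFamilies : ∀ n k → List (List (Subset n))
intersectingFamilies n k = filter intersecting? (sublists (kSubsets n k))

∈-intersectingFamilies⁻ : ∀ {n k 𝓕} → 𝓕 ∈ₗ intersectingFamilies n k → Intersecting 𝓕 × 𝓕 ⊑ kSubsets n k
∈-intersectingFamilies⁻ 𝓕∈ =
  let 𝓕∈sublists , 𝓕-intersecting = ∈-filter⁻ intersecting? 𝓕∈ in 𝓕-intersecting , sublists-⊑ 𝓕∈sublists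

restrictCount-≡0 : ∀ {n} (𝓕 : List (Subset n)) {Z} A B → Transversal 𝓕 Z → Z ⊆ B → restrictCount 𝓕 A B ≡ 0
restrictCount-≡0 𝓕 A B Z-transversal Z⊆B = cong length (filter-none _ (All.map misses-B̄ Z-transversal))
  where
  misses-B̄ : ∀ {G} → Nonempty (_ ∩ G) → ¬ (A ⊆ G × Empty (B ∩ G))
  misses-B̄ {G} (x , x∈Z∩G) (_ , B∩G-empty) = let x∈Z , x∈G = x∈p∩q⁻ _ G x∈Z∩G in Empty-∩⁻ B∩G-empty (Z⊆B x∈Z) x∈G

restrictCount-≤-heavyCount : ∀ {n k r} {𝓕 : List (Subset n)} (A B Y : Subset n) → 𝓕 ⊑ kSubsets n k →
  (∀ {G} → G ∈ₗ 𝓕 → r ≤ ∣ G ∩ Y ∣) → restrictCount 𝓕 A B ≤ heavyCount k A Y r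
restrictCount-≤-heavyCount {n} {k} {r} {𝓕} A B Y 𝓕⊑ heavy-members = begin
  restrictCount 𝓕 A B                            ≤⟨ length-filter-≤ _ (heavy? k A Y r) 𝓕 (λ G∈𝓕 (A⊆G , _) →
                                                      ∈-kSubsets⁻ (lookup 𝓕⊑ G∈𝓕) , A⊆G , heavy-members G∈𝓕) ⟩
  length (filter (heavy? k A Y r) 𝓕)             ≤⟨ length-mono-≤ (filter⁺ (heavy? k A Y r) (heavy? k A Y r) (λ { refl h → h }) 𝓕⊑subsets) ⟩
  length (filter (heavy? k A Y r) (subsets n))   ≡⟨ count≡length-filter (heavy? k A Y r) ⟨
  heavyCount k A Y r                             ∎
  where
  open ≤-Reasoning
  𝓕⊑subsets : 𝓕 ⊑ subsets n
  𝓕⊑subsets = ⊆-trans 𝓕⊑ (filter-⊆ (λ S → ∣ S ∣ ≟ k) (subsets n))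

module UpperBound (p q k n : ℕ) (n-large : kernelBound k (suc q) + (p + q) ≤ n) where

  M : ℕ
  M = kernelBound k (suc q)

  p+q≤n : p + q ≤ n
  p+q≤n = ≤-trans (m≤n+m (p + q) M) n-large

  q+p≤n : q + p ≤ n
  q+p≤n = subst (_≤ n) (+-comm p q) p+q≤n

  betaF≡0 : ∀ {𝓕 Z} → ∣ Z ∣ ≤ q → Transversal 𝓕 Z → betaF p q 𝓕 ≡ 0
  betaF≡0 {𝓕} {Z} ∣Z∣≤q Z-transversal =
    let B , Z⊆B , ∣B∣≡q , _ = superset-of-size q Z ⊥ ∣Z∣≤q q+∣⊥∣≤n (Empty-∩⁺ λ _ → ∉⊥)
        A , A∩B-empty , ∣A∣≡p = disjoint-subset-of-size p B (subst (λ x → p + x ≤ n) (sym ∣B∣≡q) p+q≤n)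
    in n≤0⇒n≡0 (≤-trans (minL-≤ _ (∈-pairs⁺ ∣A∣≡p ∣B∣≡q A∩B-empty))
                        (≤-reflexive (restrictCount-≡0 𝓕 A B Z-transversal Z⊆B)))
    where
    q+∣⊥∣≤n : q + ∣ ⊥ {n} ∣ ≤ n
    q+∣⊥∣≤n = subst (λ x → q + x ≤ n) (sym (∣⊥∣≡0 n)) (≤-trans (+-monoʳ-≤ q z≤n) q+p≤n)

  betaF-≤-heavyCount : ∀ {𝓕 Y} → 𝓕 ⊑ kSubsets n k → ∣ Y ∣ ≤ M → (∀ {G} → G ∈ₗ 𝓕 → suc q ≤ ∣ G ∩ Y ∣) →
    Σ[ A ∈ Subset n ] (∣ A ∣ ≡ p × Empty (A ∩ Y) × betaF p q 𝓕 ≤ heavyCount k A Y (suc q))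
  betaF-≤-heavyCount {𝓕} {Y} 𝓕⊑ ∣Y∣≤M Y-kernel =
    let A , A∩Y-empty , ∣A∣≡p = disjoint-subset-of-size p Y p+∣Y∣≤n
        B , B∩A-empty , ∣B∣≡q = disjoint-subset-of-size q A (subst (λ x → q + x ≤ n) (sym ∣A∣≡p) q+p≤n)
    in A , ∣A∣≡p , A∩Y-empty ,
       ≤-trans (minL-≤ _ (∈-pairs⁺ ∣A∣≡p ∣B∣≡q (Empty-∩-swap B∩A-empty)))
               (restrictCount-≤-heavyCount A B Y 𝓕⊑ Y-kernel)
    where
    p+∣Y∣≤n : p + ∣ Y ∣ ≤ n
    p+∣Y∣≤n = begin
      p + ∣ Y ∣          ≤⟨ +-monoʳ-≤ p ∣Y∣≤M ⟩
      p + M              ≡⟨ +-comm p M ⟩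
      M + p              ≤⟨ +-monoʳ-≤ M (m≤m+n p q) ⟩
      M + (p + q)        ≤⟨ n-large ⟩
      n                  ∎
      where open ≤-Reasoning

  beta-≤ : ∀ {b} → (∀ {A Y} → ∣ A ∣ ≡ p → ∣ Y ∣ ≤ M → Empty (A ∩ Y) → heavyCount k A Y (suc q) ≤ b) →
           beta p q n k ≤ b
  beta-≤ {b} heavy≤b = maxL-lub (betaF p q) (intersectingFamilies n k) betaF≤b
    where
    betaF≤b : ∀ {𝓕} → 𝓕 ∈ₗ intersectingFamilies n k → betaF p q 𝓕 ≤ b
    betaF≤b {𝓕} 𝓕∈ with ∈-intersectingFamilies⁻ 𝓕∈
    ... | 𝓕-intersecting , 𝓕⊑
      with Kernel.small-transversal-or-kernel 𝓕 𝓕-intersecting (∈-kSubsets⁻ ∘ lookup 𝓕⊑) (suc q)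
    ... | inj₁ (Z , ∣Z∣<1+q , Z-transversal) = ≤-trans (≤-reflexive (betaF≡0 (s≤s⁻¹ ∣Z∣<1+q) Z-transversal)) z≤n
    ... | inj₂ (Y , ∣Y∣≤M , Y-kernel) =
      let A , ∣A∣≡p , A∩Y-empty , β≤ = betaF-≤-heavyCount 𝓕⊑ ∣Y∣≤M Y-kernel
      in ≤-trans β≤ (heavy≤b ∣A∣≡p ∣Y∣≤M A∩Y-empty)

beta≡0 : ∀ p q k n → k ≤ p + q → kernelBound k (suc q) + (p + q) ≤ n → beta p q n k ≡ 0
beta≡0 p q k n k≤p+q n-large = n≤0⇒n≡0 (beta-≤ λ {A} {Y} ∣A∣≡p _ A∩Y-empty →
  ≤-reflexive (heavyCount-< A Y A∩Y-empty (subst (λ a → k < a + suc q) (sym ∣A∣≡p) k<p+[1+q])))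
  where
  open UpperBound p q k n n-large
  k<p+[1+q] : k < p + suc q
  k<p+[1+q] = ≤-trans (s≤s k≤p+q) (≤-reflexive (sym (+-suc p q)))

beta-≤-^ : ∀ p q k n → p + q < k → kernelBound k (suc q) + (p + q) ≤ n →
           beta p q n k ≤ kernelBound k (suc q) ^ suc q * n ^ (k ∸ 1 ∸ p ∸ q)
beta-≤-^ p q k n p+q<k n-large = beta-≤ λ {A} {Y} ∣A∣≡p ∣Y∣≤M A∩Y-empty → begin
  heavyCount k A Y (suc q)              ≤⟨ heavyCount-≤ (suc q) d A Y A∩Y-empty
                                              (subst (λ a → k ≡ a + suc q + d) (sym ∣A∣≡p) k≡p+[1+q]+d) ⟩
  (∣ Y ∣ choose suc q) * (n choose d)   ≤⟨ *-mono-≤ (nCk≤n^k ∣ Y ∣ (suc q)) (nCk≤n^k n d) ⟩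
  ∣ Y ∣ ^ suc q * n ^ d                 ≤⟨ *-monoˡ-≤ (n ^ d) (^-monoˡ-≤ (suc q) ∣Y∣≤M) ⟩
  M ^ suc q * n ^ d                     ∎
  where
  open UpperBound p q k n n-large
  open ≤-Reasoning
  d : ℕ
  d = k ∸ 1 ∸ p ∸ q
  k≡p+[1+q]+d : k ≡ p + suc q + d
  k≡p+[1+q]+d = k≡p+[1+q]+[k∸1∸p∸q] p q k p+q<k

-- Lower bound: majority families

Thick : ∀ {n} → ℕ → Subset n → Subset n → Set
Thick q T S = suc q ≤ ∣ S ∩ T ∣

thick? : ∀ {n} q (T : Subset n) → Decidable (Thick q T)
thick? q T S = suc q ≤? ∣ S ∩ T ∣

thick-meet : ∀ {n q} {T G H : Subset n} → ∣ T ∣ ≡ q + suc q → Thick q T G → Thick q T H → Nonempty (G ∩ H)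
thick-meet {q = q} {T} {G} {H} ∣T∣≡q+[1+q] G-thick H-thick =
  w , x∈p∩q⁺ (proj₁ (x∈p∩q⁻ G T w∈G∩T) , proj₁ (x∈p∩q⁻ H T w∈H∩T))
  where
  X : Subset _
  X = (G ∩ T) ∩ (H ∩ T)
  t = q + suc q
  t+1≤t+∣X∣ : t + 1 ≤ t + ∣ X ∣
  t+1≤t+∣X∣ = begin
    t + 1                      ≡⟨ +-comm t 1 ⟩
    suc q + suc q              ≤⟨ +-mono-≤ G-thick H-thick ⟩
    ∣ G ∩ T ∣ + ∣ H ∩ T ∣      ≤⟨ ∣p∣+∣q∣≤∣r∣+∣p∩q∣ (p∩q⊆q G T) (p∩q⊆q H T) ⟩
    ∣ T ∣ + ∣ X ∣              ≡⟨ cong (_+ ∣ X ∣) ∣T∣≡q+[1+q] ⟩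
    t + ∣ X ∣                  ∎
    where open ≤-Reasoning
  X-nonempty = ∣p∣>0⇒Nonempty X (+-cancelˡ-≤ t 1 ∣ X ∣ t+1≤t+∣X∣)
  w = proj₁ X-nonempty
  w∈G∩T = proj₁ (x∈p∩q⁻ (G ∩ T) (H ∩ T) (proj₂ X-nonempty))
  w∈H∩T = proj₂ (x∈p∩q⁻ (G ∩ T) (H ∩ T) (proj₂ X-nonempty))

thickFamily : ∀ n k q → Subset n → List (Subset n)
thickFamily n k q T = filter (thick? q T) (kSubsets n k)

thickFamily-intersecting : ∀ {n k q} {T : Subset n} → ∣ T ∣ ≡ q + suc q → Intersecting (thickFamily n k q T)
thickFamily-intersecting {n} {k} {q} {T} ∣T∣≡q+[1+q] = All.tabulate λ G∈ → All.tabulate λ H∈ →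
  thick-meet ∣T∣≡q+[1+q] (thick-member G∈) (thick-member H∈)
  where
  thick-member : ∀ {G} → G ∈ₗ thickFamily n k q T → Thick q T G
  thick-member = proj₂ ∘ ∈-filter⁻ (thick? q T) {xs = kSubsets n k}

module LowerBound (p q k n : ℕ) (p+q<k : p + q < k) (c≤n : p + suc q + q ≤ n) where

  c d : ℕ
  c = p + suc q + q
  d = k ∸ 1 ∸ p ∸ q

  p+q≤n : p + q ≤ n
  p+q≤n = ≤-trans (≤-trans (+-monoʳ-≤ p (n≤1+n q)) (m≤m+n (p + suc q) q)) c≤n

  q+p≤n : q + p ≤ n
  q+p≤n = subst (_≤ n) (+-comm p q) p+q≤n

  q+[1+q]≤n : q + suc q ≤ n
  q+[1+q]≤n = begin
    q + suc q          ≡⟨ +-comm q (suc q) ⟩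
    suc q + q          ≤⟨ m≤n+m (suc q + q) p ⟩
    p + (suc q + q)    ≡⟨ +-assoc p (suc q) q ⟨
    c                  ≤⟨ c≤n ⟩
    n                  ∎
    where open ≤-Reasoning

  module _ (T : Subset n) (∣T∣≡q+[1+q] : ∣ T ∣ ≡ q + suc q) where

    restrictCount-≥-sandwichCount : ∀ {A B Z W} → Z ⊆ T → ∣ Z ∣ ≡ suc q → A ⊆ W → Z ⊆ W →
      ∣ W ∣ ≡ p + suc q → ∣ B ∣ ≡ q → Empty (W ∩ B) → (n ∸ c) choose d ≤ restrictCount (thickFamily n k q T) A B
    restrictCount-≥-sandwichCount {A} {B} {Z} {W} Z⊆T ∣Z∣≡1+q A⊆W Z⊆W ∣W∣≡p+[1+q] ∣B∣≡q W∩B-empty = begin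
      (n ∸ c) choose d                                      ≡⟨ cong (_choose d) ∣∁[W∪B]∣≡n∸c ⟨
      ∣ ∁ (W ∪ B) ∣ choose d                                ≡⟨ sandwichCount-≡ d W B W∩B-empty ⟨
      sandwichCount (∣ W ∣ + d) W B                         ≡⟨ cong (λ x → sandwichCount x W B) ∣W∣+d≡k ⟩
      sandwichCount k W B                                   ≡⟨ count≡length-filter (sandwiched? k W B) ⟩
      length (filter (sandwiched? k W B) (subsets n))       ≤⟨ length-filter-≤-filter∘filter _ (λ S → ∣ S ∣ ≟ k) _
                                                                 proj₁ (λ h → h) (subsets n) ⟩
      length (filter (sandwiched? k W B) (kSubsets n k))    ≤⟨ length-filter-≤-filter∘filter _ (thick? q T) _
                                                                 thick in-restriction (kSubsets n k) ⟩
      restrictCount (thickFamily n k q T) A B               ∎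
      where
      open ≤-Reasoning
      ∣∁[W∪B]∣≡n∸c : ∣ ∁ (W ∪ B) ∣ ≡ n ∸ c
      ∣∁[W∪B]∣≡n∸c = trans (∣∁p∣≡n∸∣p∣ (W ∪ B))
        (cong (n ∸_) (trans (Empty⇒∣p∪q∣≡∣p∣+∣q∣ W∩B-empty) (cong₂ _+_ ∣W∣≡p+[1+q] ∣B∣≡q)))
      ∣W∣+d≡k : ∣ W ∣ + d ≡ k
      ∣W∣+d≡k = trans (cong (_+ d) ∣W∣≡p+[1+q]) (sym (k≡p+[1+q]+[k∸1∸p∸q] p q k p+q<k))
      thick : ∀ {S} → Sandwiched k W B S → Thick q T S
      thick (_ , W⊆S , _) = subst (_≤ _) ∣Z∣≡1+q (p⊆q⇒∣p∣≤∣q∣ λ x∈Z → x∈p∩q⁺ (W⊆S (Z⊆W x∈Z) , Z⊆T x∈Z))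
      in-restriction : ∀ {S} → Sandwiched k W B S → A ⊆ S × Empty (B ∩ S)
      in-restriction (_ , W⊆S , S∩B-empty) = W⊆S ∘ A⊆W , Empty-∩-swap S∩B-empty

    restrictCount-thick-≥ : ∀ {A B} → ∣ A ∣ ≡ p → ∣ B ∣ ≡ q → Empty (A ∩ B) →
                            (n ∸ c) choose d ≤ restrictCount (thickFamily n k q T) A B
    restrictCount-thick-≥ {A} {B} ∣A∣≡p ∣B∣≡q A∩B-empty =
      let Z , Z⊆T∩∁B , ∣Z∣≡1+q = subset-of-size (T ∩ ∁ B) 1+q≤∣T∩∁B∣
          Z⊆T  = λ {x} x∈Z → proj₁ (x∈p∩q⁻ T (∁ B) (Z⊆T∩∁B {x} x∈Z))
          Z⊆∁B = λ {x} x∈Z → proj₂ (x∈p∩q⁻ T (∁ B) (Z⊆T∩∁B {x} x∈Z))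
          W , A∪Z⊆W , ∣W∣≡p+[1+q] , W∩B-empty =
            superset-of-size (p + suc q) (A ∪ Z) B (∣A∪Z∣≤ ∣Z∣≡1+q) (subst (λ x → p + suc q + x ≤ n) (sym ∣B∣≡q) c≤n)
                             (Empty-∩⁺ (A∪Z-avoids-B Z⊆∁B))
      in restrictCount-≥-sandwichCount Z⊆T ∣Z∣≡1+q (A∪Z⊆W ∘ p⊆p∪q Z) (A∪Z⊆W ∘ q⊆p∪q A Z) ∣W∣≡p+[1+q] ∣B∣≡q W∩B-empty
      where
      1+q≤∣T∩∁B∣ : suc q ≤ ∣ T ∩ ∁ B ∣
      1+q≤∣T∩∁B∣ = +-cancelʳ-≤ q (suc q) ∣ T ∩ ∁ B ∣
        (subst₂ _≤_ (trans ∣T∣≡q+[1+q] (+-comm q (suc q))) (cong (∣ T ∩ ∁ B ∣ +_) ∣B∣≡q) (∣p∣≤∣p∩∁q∣+∣q∣ T B))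
      ∣A∪Z∣≤ : ∀ {Z} → ∣ Z ∣ ≡ suc q → ∣ A ∪ Z ∣ ≤ p + suc q
      ∣A∪Z∣≤ {Z} ∣Z∣≡1+q = ≤-trans (∣p∪q∣≤∣p∣+∣q∣ A Z) (≤-reflexive (cong₂ _+_ ∣A∣≡p ∣Z∣≡1+q))
      A∪Z-avoids-B : ∀ {Z} → Z ⊆ ∁ B → ∀ {x} → x ∈ A ∪ Z → x ∉ B
      A∪Z-avoids-B {Z} Z⊆∁B x∈A∪Z with x∈p∪q⁻ A Z x∈A∪Z
      ... | inj₁ x∈A = Empty-∩⁻ A∩B-empty x∈A
      ... | inj₂ x∈Z = x∈∁p⇒x∉p (Z⊆∁B x∈Z)

  beta-≥ : (n ∸ c) choose d ≤ beta p q n k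
  beta-≥ =
    let T , _ , ∣T∣≡q+[1+q] = subset-of-size ⊤ (subst (q + suc q ≤_) (sym (∣⊤∣≡n n)) q+[1+q]≤n)
        A₀ , _ , ∣A₀∣≡p = disjoint-subset-of-size p ⊥ (subst (λ x → p + x ≤ n) (sym (∣⊥∣≡0 n)) p+0≤n)
        B₀ , B₀∩A₀-empty , ∣B₀∣≡q = disjoint-subset-of-size q A₀ (subst (λ x → q + x ≤ n) (sym ∣A₀∣≡p) q+p≤n)
        𝓜∈ = ∈-filter⁺ intersecting? (filter∈sublists (thick? q T) (kSubsets n k))
                        (thickFamily-intersecting ∣T∣≡q+[1+q])
    in ≤-trans (≤-minL _ (∈-pairs⁺ ∣A₀∣≡p ∣B₀∣≡q (Empty-∩-swap B₀∩A₀-empty)) λ { {A , B} AB∈ →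
                  let ∣A∣≡p , ∣B∣≡q , A∩B-empty = ∈-pairs⁻ AB∈ in restrictCount-thick-≥ T ∣T∣≡q+[1+q] ∣A∣≡p ∣B∣≡q A∩B-empty })
               (≤-maxL (betaF p q) 𝓜∈)
    where
    p+0≤n : p + 0 ≤ n
    p+0≤n = ≤-trans (+-monoʳ-≤ p z≤n) p+q≤n

0<n*m⇒0<m : ∀ n {m} → 0 < n * m → 0 < m
0<n*m⇒0<m n {zero}  0<n*0 = ⊥-elim (<⇒≢ 0<n*0 (sym (*-zeroʳ n)))
0<n*m⇒0<m n {suc m} _     = s≤s z≤n

corollary1p3 : (p q k : ℕ) →
    ((∃[ N ] ((n : ℕ) → N ≤ n → 0 < beta p q n k)) ⇔ (p + q < k))
    × (p + q < k →
        ∃[ C ] ∃[ N ] ((n : ℕ) → N ≤ n →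
          (n ^ (k ∸ 1 ∸ p ∸ q) ≤ C * beta p q n k)
          × (beta p q n k ≤ C * n ^ (k ∸ 1 ∸ p ∸ q))))
corollary1p3 p q k = mk⇔ eventually-positive⇒p+q<k p+q<k⇒eventually-positive , Θ
  where
  c d M N C : ℕ
  c = p + suc q + q
  d = k ∸ 1 ∸ p ∸ q
  M = kernelBound k (suc q)
  N = M + (p + q) + 2 * (c + d)
  C = 2 ^ d * d ! + M ^ suc q

  Θ : p + q < k → ∃[ C ] ∃[ N ] ((n : ℕ) → N ≤ n → (n ^ d ≤ C * beta p q n k) × (beta p q n k ≤ C * n ^ d))
  Θ p+q<k = C , N , λ n N≤n →
    let upper-large = ≤-trans (m≤m+n (M + (p + q)) (2 * (c + d))) N≤n
        lower-large = ≤-trans (m≤n+m (2 * (c + d)) (M + (p + q))) N≤n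
        c≤n         = ≤-trans (≤-trans (m≤m+n c d) (m≤m+n (c + d) (c + d + 0))) lower-large
    in ≤-trans (n^d≤[2^d*d!]*[n∸c]Cd n c d lower-large)
               (≤-trans (*-monoʳ-≤ (2 ^ d * d !) (LowerBound.beta-≥ p q k n p+q<k c≤n))
                        (*-monoˡ-≤ (beta p q n k) (m≤m+n (2 ^ d * d !) (M ^ suc q)))) ,
       ≤-trans (beta-≤-^ p q k n p+q<k upper-large) (*-monoˡ-≤ (n ^ d) (m≤n+m (M ^ suc q) (2 ^ d * d !)))

  eventually-positive⇒p+q<k : ∃[ N₀ ] ((n : ℕ) → N₀ ≤ n → 0 < beta p q n k) → p + q < k
  eventually-positive⇒p+q<k (N₀ , positive) with p + q <? k
  ... | yes p+q<k = p+q<k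
  ... | no  p+q≮k = ⊥-elim (<⇒≢ (positive n (m≤m+n N₀ _)) (sym (beta≡0 p q k n (≮⇒≥ p+q≮k) (m≤n+m _ N₀))))
    where n = N₀ + (M + (p + q))

  p+q<k⇒eventually-positive : p + q < k → ∃[ N₀ ] ((n : ℕ) → N₀ ≤ n → 0 < beta p q n k)
  p+q<k⇒eventually-positive p+q<k = suc N , positive
    where
    positive : (n : ℕ) → suc N ≤ n → 0 < beta p q n k
    positive (suc n) (s≤s N≤n) =
      0<n*m⇒0<m C (≤-trans (m^n>0 (suc n) d) (proj₁ (proj₂ (proj₂ (Θ p+q<k)) (suc n) (m≤n⇒m≤1+n N≤n))))
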